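{- Let $\mathbb{F}_4=\{0,1,\alpha,\alpha^2\}$ with $\alpha^2=\alpha+1$, $V=\mathbb{F}_4^{\,5}$, let $L$ be the line spanned by $(0,1,1,1,1)$ and $(1,0,1,\alpha,\alpha^2)$, and let $L_{136}$ be the line spanned by $(0,1,1,\alpha,\alpha)$ and $(1,0,1,\alpha^2,1)$. Then $\mathrm{G}(L_{136})\cap\mathrm{G}(L)$ is a group of order $6$.
   Context: A simplex line is a $2$-dimensional subspace of $V$ all of whose non-zero vectors have precisely one zero coordinate ($L$ and $L_{136}$ are such lines). A map $l:V\to V$ is semilinear if it is additive and there is a field automorphism $\sigma$ of $\mathbb{F}_4$ with $l(ax)=\sigma(a)l(x)$; a semilinear automorphism is monomial if it sends every standard basis vector $e_i$ to a non-zero scalar multiple of some $e_j$. Each semilinear automorphism induces a bijective transformation of the set of subspaces of $V$ (a projective transformation). For a simplex line $M$, $\mathrm{G}(M)$ is the group of all projective transformations induced by monomial semilinear automorphisms of $V$ that preserve $M$. -}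

module Defs where

open import Data.Nat using (ℕ)
open import Data.Fin using (Fin)
open import Data.Vec using (Vec; []; _∷_; zipWith; map; replicate; updateAt; lookup)
open import Data.Product using (Σ; ∃; _×_; _,_)
open import Relation.Binary.PropositionalEquality using (_≡_; _≢_)
open import Relation.Nullary using (¬_)
open import Function.Definitions using (Bijective)

data F4 : Set where
  𝟎 𝟏 α α² : F4

infixl 6 _⊕_
infixl 7 _⊗_

_⊕_ : F4 → F4 → F4
𝟎  ⊕ y  = y
x  ⊕ 𝟎  = x
𝟏  ⊕ 𝟏  = 𝟎
𝟏  ⊕ α  = α²
𝟏  ⊕ α² = α
α  ⊕ 𝟏  = α²
α  ⊕ α  = 𝟎
α  ⊕ α² = 𝟏
α² ⊕ 𝟏  = α
α² ⊕ α  = 𝟏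
α² ⊕ α² = 𝟎

_⊗_ : F4 → F4 → F4
𝟎  ⊗ y  = 𝟎
x  ⊗ 𝟎  = 𝟎
𝟏  ⊗ y  = y
x  ⊗ 𝟏  = x
α  ⊗ α  = α²
α  ⊗ α² = 𝟏
α² ⊗ α  = 𝟏
α² ⊗ α² = α

record IsFieldAut (σ : F4 → F4) : Set where
  field
    bij  : Bijective _≡_ _≡_ σ
    hom+ : ∀ a b → σ (a ⊕ b) ≡ σ a ⊕ σ b
    hom* : ∀ a b → σ (a ⊗ b) ≡ σ a ⊗ σ b
    hom1 : σ 𝟏 ≡ 𝟏

V : Set
V = Vec F4 5

infixl 6 _+V_
infixl 7 _·V_

_+V_ : V → V → V
_+V_ = zipWith _⊕_

_·V_ : F4 → V → V
a ·V x = map (a ⊗_) x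

0V : V
0V = replicate 5 𝟎

e : Fin 5 → V
e i = updateAt 0V i (λ _ → 𝟏)

record MonSemilinAut : Set where
  field
    fun       : V → V
    σ         : F4 → F4
    σ-aut     : IsFieldAut σ
    additive  : ∀ x y → fun (x +V y) ≡ fun x +V fun y
    semilin   : ∀ a x → fun (a ·V x) ≡ σ a ·V fun x
    bijective : Bijective _≡_ _≡_ fun
    monomial  : ∀ i → Σ (Fin 5) λ j → Σ F4 λ c → c ≢ 𝟎 × fun (e i) ≡ c ·V e j

open MonSemilinAut public

record Subspace : Set₁ where
  field
    mem   : V → Set
    has0  : mem 0V
    add   : ∀ x y → mem x → mem y → mem (x +V y)
    scal  : ∀ a x → mem x → mem (a ·V x)

open Subspace public

image : (V → V) → (V → Set) → V → Set
image l P y = Σ V λ x → P x × l x ≡ y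

SameSet : (V → Set) → (V → Set) → Set
SameSet P Q = ∀ y → (P y → Q y) × (Q y → P y)

-- two semilinear automorphisms induce the same projective transformation
-- (the same map W ↦ l(W) on the set of subspaces of V)
SameProj : MonSemilinAut → MonSemilinAut → Set₁
SameProj g h = ∀ (W : Subspace) → SameSet (image (fun g) (mem W)) (image (fun h) (mem W))

span₂ : V → V → V → Set
span₂ u v x = Σ F4 λ a → Σ F4 λ b → x ≡ a ·V u +V b ·V v

Preserves : (V → Set) → MonSemilinAut → Set
Preserves M g = SameSet (image (fun g) M) M

L : V → Set
L = span₂ (𝟎 ∷ 𝟏 ∷ 𝟏 ∷ 𝟏 ∷ 𝟏 ∷ []) (𝟏 ∷ 𝟎 ∷ 𝟏 ∷ α ∷ α² ∷ [])

L136 : V → Set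
L136 = span₂ (𝟎 ∷ 𝟏 ∷ 𝟏 ∷ α ∷ α ∷ []) (𝟏 ∷ 𝟎 ∷ 𝟏 ∷ α² ∷ 𝟏 ∷ [])

-- A monomial semilinear automorphism sends x to Σᵢ σ(xᵢ) cᵢ e_{π(i)}, where σ is the identity or the
-- Frobenius a ↦ a² (the only automorphisms of F4), π is a permutation and the cᵢ are non-zero.
-- Running through all 2 · 5! · 3⁵ such data, those sending the given bases of L and L136 into the
-- lines are exactly the non-zero multiples of six linear maps, which permute the first three
-- coordinates as S₃; each of the six has order dividing 6, hence is bijective and preserves both
-- lines. Proportional maps induce the same projective transformation, and the six induced
-- transformations are told apart by the image of the line through a single vector.

module Submission where

open import Defs
open import Data.Bool.ListAction using (all; any)
open import Data.Empty using (⊥-elim)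
open import Data.Fin using (Fin; zero; suc)
open import Data.Fin.Patterns using (0F; 1F; 2F; 3F; 4F; 5F)
import Data.Fin.Properties as Finₚ
open import Data.List using (List; []; _∷_; filter; cartesianProductWith; allFin)
open import Data.List.Membership.Propositional using (_∈_; find; lose)
open import Data.List.Membership.Propositional.Properties
  using (∈-cartesianProductWith⁺; ∈-allFin; ∈-filter⁺)
import Data.List.Relation.Unary.All as All
open import Data.List.Relation.Unary.All.Properties using (all⁺; all⁻)
open import Data.List.Relation.Unary.Any using (here; there)
open import Data.List.Relation.Unary.Any.Properties using (any⁺; any⁻)
open import Data.Nat using (ℕ)
import Data.Nat as ℕ
open import Data.Nat.GeneralisedArithmetic using (iterate)
open import Data.Product using (Σ; ∃; ∃₂; _×_; _,_; proj₁; proj₂)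
open import Data.Sum using (_⊎_; [_,_]′)
open import Data.Vec using (Vec; []; _∷_; lookup; tabulate; map; zipWith; foldr′)
import Data.Vec.Properties as Vecₚ
open import Function using (_∘_)
open import Function.Definitions using (Bijective)
open import Relation.Binary.Definitions using (DecidableEquality)
open import Relation.Unary using (Decidable)
open import Relation.Binary.PropositionalEquality
  using (_≡_; _≢_; _≗_; refl; sym; trans; cong; cong₂; subst; module ≡-Reasoning)
open import Relation.Nullary using (Dec; yes; no)
open import Relation.Nullary.Decidable using (isYes; T?; toWitness; fromWitness; map′; _×-dec_; _⊎-dec_; _→-dec_; ¬?)

open ≡-Reasoning

-- Deciding quantifiers over lists and enumerated types

-- Both decisions are Boolean folds underneath, so a proof `toWitness {a? = …} _` only has to evaluate
-- Booleans; normalising `Data.List.Relation.Unary.All.all?` or `Data.Fin.Properties.all?` instead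
-- makes proofs by exhaustion far more expensive.
module _ {A : Set} {P : A → Set} (P? : Decidable P) (xs : List A) where

  ∀∈? : Dec (∀ {x} → x ∈ xs → P x)
  ∀∈? = map′ (λ h x∈xs → toWitness (All.lookup (all⁺ (isYes ∘ P?) xs h) x∈xs))
             (λ h → all⁻ (isYes ∘ P?) (All.tabulate (fromWitness ∘ h)))
             (T? (all (isYes ∘ P?) xs))

  ∃∈? : Dec (∃ λ x → x ∈ xs × P x)
  ∃∈? = map′ (λ h → let x , x∈xs , px = find (any⁻ (isYes ∘ P?) xs h) in x , x∈xs , toWitness px)
             (λ (x , x∈xs , px) → any⁺ (isYes ∘ P?) (lose x∈xs (fromWitness px)))
             (T? (any (isYes ∘ P?) xs))

module _ {A : Set} {P : A → Set} (xs : List A) (enumerates : ∀ x → x ∈ xs) (P? : Decidable P) where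

  ∀-by-enumeration? : Dec (∀ x → P x)
  ∀-by-enumeration? = map′ (λ h x → h (enumerates x)) (λ h {x} _ → h x) (∀∈? P? xs)

  ∃-by-enumeration? : Dec (∃ P)
  ∃-by-enumeration? = map′ (λ (x , _ , px) → x , px) (λ (x , px) → x , enumerates x , px) (∃∈? P? xs)

∀Fin? : ∀ {n} {P : Fin n → Set} → Decidable P → Dec (∀ i → P i)
∀Fin? = ∀-by-enumeration? (allFin _) ∈-allFin

∃Fin? : ∀ {n} {P : Fin n → Set} → Decidable P → Dec (∃ P)
∃Fin? = ∃-by-enumeration? (allFin _) ∈-allFin

vectors : {A : Set} → List A → ∀ n → List (Vec A n)
vectors xs ℕ.zero    = [] ∷ []
vectors xs (ℕ.suc n) = cartesianProductWith _∷_ xs (vectors xs n)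

∈-vectors : ∀ {A : Set} {xs : List A} {n} (v : Vec A n) → (∀ i → lookup v i ∈ xs) → v ∈ vectors xs n
∈-vectors []      _ = here refl
∈-vectors (x ∷ v) h = ∈-cartesianProductWith⁺ _∷_ (h zero) (∈-vectors v (h ∘ suc))

infix 4 _≟_ _≟ⱽ_
infix 8 _⁻¹

_≟_ : DecidableEquality F4
𝟎  ≟ 𝟎  = yes refl
𝟎  ≟ 𝟏  = no λ ()
𝟎  ≟ α  = no λ ()
𝟎  ≟ α² = no λ ()
𝟏  ≟ 𝟎  = no λ ()
𝟏  ≟ 𝟏  = yes refl
𝟏  ≟ α  = no λ ()
𝟏  ≟ α² = no λ ()
α  ≟ 𝟎  = no λ ()
α  ≟ 𝟏  = no λ ()
α  ≟ α  = yes refl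
α  ≟ α² = no λ ()
α² ≟ 𝟎  = no λ ()
α² ≟ 𝟏  = no λ ()
α² ≟ α  = no λ ()
α² ≟ α² = yes refl

_≟ⱽ_ : ∀ {n} → DecidableEquality (Vec F4 n)
_≟ⱽ_ = Vecₚ.≡-dec _≟_

allF4 : List F4
allF4 = 𝟎 ∷ 𝟏 ∷ α ∷ α² ∷ []

∈-allF4 : ∀ a → a ∈ allF4
∈-allF4 𝟎  = here refl
∈-allF4 𝟏  = there (here refl)
∈-allF4 α  = there (there (here refl))
∈-allF4 α² = there (there (there (here refl)))

units : List F4
units = 𝟏 ∷ α ∷ α² ∷ []

∈-units : ∀ {a} → a ≢ 𝟎 → a ∈ units
∈-units {𝟎}  a≢𝟎 = ⊥-elim (a≢𝟎 refl)
∈-units {𝟏}  _   = here refl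
∈-units {α}  _   = there (here refl)
∈-units {α²} _   = there (there (here refl))

∈-units⇒≢𝟎 : ∀ {a} → a ∈ units → a ≢ 𝟎
∈-units⇒≢𝟎 (here refl)                 ()
∈-units⇒≢𝟎 (there (here refl))         ()
∈-units⇒≢𝟎 (there (there (here refl))) ()

∀F4? : {P : F4 → Set} → Decidable P → Dec (∀ a → P a)
∀F4? = ∀-by-enumeration? allF4 ∈-allF4

⊗-assoc : ∀ a b c → (a ⊗ b) ⊗ c ≡ a ⊗ (b ⊗ c)
⊗-assoc = toWitness {a? = ∀F4? λ a → ∀F4? λ b → ∀F4? λ c → (a ⊗ b) ⊗ c ≟ a ⊗ (b ⊗ c)} _

⊗-distribʳ-⊕ : ∀ a b c → (b ⊕ c) ⊗ a ≡ b ⊗ a ⊕ c ⊗ a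
⊗-distribʳ-⊕ = toWitness {a? = ∀F4? λ a → ∀F4? λ b → ∀F4? λ c → (b ⊕ c) ⊗ a ≟ b ⊗ a ⊕ c ⊗ a} _

⊗-identityˡ : ∀ a → 𝟏 ⊗ a ≡ a
⊗-identityˡ = toWitness {a? = ∀F4? λ a → 𝟏 ⊗ a ≟ a} _

⊗-identityʳ : ∀ a → a ⊗ 𝟏 ≡ a
⊗-identityʳ = toWitness {a? = ∀F4? λ a → a ⊗ 𝟏 ≟ a} _

⊗-zeroʳ : ∀ a → a ⊗ 𝟎 ≡ 𝟎
⊗-zeroʳ = toWitness {a? = ∀F4? λ a → a ⊗ 𝟎 ≟ 𝟎} _

⊕-identityʳ : ∀ a → a ⊕ 𝟎 ≡ a
⊕-identityʳ = toWitness {a? = ∀F4? λ a → a ⊕ 𝟎 ≟ a} _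

-- 𝟎 ⁻¹ = 𝟎 is a junk value.
_⁻¹ : F4 → F4
𝟎  ⁻¹ = 𝟎
𝟏  ⁻¹ = 𝟏
α  ⁻¹ = α²
α² ⁻¹ = α

⊗-inverseʳ : ∀ {a} → a ≢ 𝟎 → a ⊗ a ⁻¹ ≡ 𝟏
⊗-inverseʳ {𝟎}  a≢𝟎 = ⊥-elim (a≢𝟎 refl)
⊗-inverseʳ {𝟏}  _   = refl
⊗-inverseʳ {α}  _   = refl
⊗-inverseʳ {α²} _   = refl

data Galois : Set where
  identity frobenius : Galois

⟦_⟧ : Galois → F4 → F4
⟦ identity  ⟧ a = a
⟦ frobenius ⟧ a = a ⊗ a

galois : List Galois
galois = identity ∷ frobenius ∷ []

∈-galois : ∀ s → s ∈ galois
∈-galois identity  = here refl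
∈-galois frobenius = there (here refl)

module _ {σ : F4 → F4} (aut : IsFieldAut σ) where
  open IsFieldAut aut

  aut-𝟎 : σ 𝟎 ≡ 𝟎
  aut-𝟎 = trans (hom+ 𝟏 𝟏) (cong₂ _⊕_ hom1 hom1)

  aut-α² : σ α² ≡ 𝟏 ⊕ σ α
  aut-α² = trans (hom+ 𝟏 α) (cong (_⊕ σ α) hom1)

  -- σ α is again a root of x² = x + 1, i.e. α or α².
  aut-classification : ∃ λ s → σ ≗ ⟦ s ⟧
  aut-classification = classify (σ α) refl (trans (sym (hom* α α)) aut-α²)
    where
    classify : ∀ b → σ α ≡ b → b ⊗ b ≡ 𝟏 ⊕ b → ∃ λ s → σ ≗ ⟦ s ⟧
    classify α σα≡b _ =
      identity , λ { 𝟎 → aut-𝟎 ; 𝟏 → hom1 ; α → σα≡b ; α² → trans aut-α² (cong (𝟏 ⊕_) σα≡b) }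
    classify α² σα≡b _ =
      frobenius , λ { 𝟎 → aut-𝟎 ; 𝟏 → hom1 ; α → σα≡b ; α² → trans aut-α² (cong (𝟏 ⊕_) σα≡b) }

identity-aut : IsFieldAut (λ a → a)
identity-aut = record
  { bij  = (λ a≡b → a≡b) , (λ b → b , λ a≡b → a≡b)
  ; hom+ = λ _ _ → refl
  ; hom* = λ _ _ → refl
  ; hom1 = refl
  }

·V-assoc : ∀ a b w → a ·V (b ·V w) ≡ (a ⊗ b) ·V w
·V-assoc a b w = trans (sym (Vecₚ.map-∘ (a ⊗_) (b ⊗_) w)) (Vecₚ.map-cong (λ x → sym (⊗-assoc a b x)) w)

·V-identityˡ : ∀ w → 𝟏 ·V w ≡ w
·V-identityˡ w = trans (Vecₚ.map-cong ⊗-identityˡ w) (Vecₚ.map-id w)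

·V-zeroˡ : ∀ w → 𝟎 ·V w ≡ 0V
·V-zeroˡ w = Vecₚ.map-const w 𝟎

·V-distribʳ : ∀ a b w → a ·V w +V b ·V w ≡ (a ⊕ b) ·V w
·V-distribʳ a b = distrib
  where
  distrib : ∀ {n} (w : Vec F4 n) → zipWith _⊕_ (map (a ⊗_) w) (map (b ⊗_) w) ≡ map ((a ⊕ b) ⊗_) w
  distrib []      = refl
  distrib (x ∷ w) = cong₂ _∷_ (sym (⊗-distribʳ-⊕ x a b)) (distrib w)

lookup-0V : ∀ k → lookup 0V k ≡ 𝟎
lookup-0V k = Vecₚ.lookup-replicate k 𝟎

lookup-e-≡ : ∀ k → lookup (e k) k ≡ 𝟏
lookup-e-≡ k = Vecₚ.lookup∘updateAt k 0V

lookup-e-≢ : ∀ {j k} → j ≢ k → lookup (e j) k ≡ 𝟎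
lookup-e-≢ {j} {k} j≢k = trans (Vecₚ.lookup∘updateAt′ k j (j≢k ∘ sym) 0V) (lookup-0V k)

≡-by-lookup : ∀ {A : Set} {n} {xs ys : Vec A n} → (∀ k → lookup xs k ≡ lookup ys k) → xs ≡ ys
≡-by-lookup {xs = xs} {ys} h = trans (sym (Vecₚ.tabulate∘lookup xs)) (trans (Vecₚ.tabulate-cong h) (Vecₚ.tabulate∘lookup ys))

∑ : ∀ {n} → Vec V n → V
∑ = foldr′ _+V_ 0V

lookup-∑-vanishing : ∀ {n} (vs : Vec V n) k → (∀ i → lookup (lookup vs i) k ≡ 𝟎) → lookup (∑ vs) k ≡ 𝟎
lookup-∑-vanishing []       k _ = lookup-0V k
lookup-∑-vanishing (v ∷ vs) k h = begin
  lookup (v +V ∑ vs) k             ≡⟨ Vecₚ.lookup-zipWith _⊕_ k v (∑ vs) ⟩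
  lookup v k ⊕ lookup (∑ vs) k     ≡⟨ cong₂ _⊕_ (h zero) (lookup-∑-vanishing vs k (h ∘ suc)) ⟩
  𝟎                                ∎

allV : List V
allV = vectors allF4 5

∈-allV : ∀ x → x ∈ allV
∈-allV x = ∈-vectors x (∈-allF4 ∘ lookup x)

∀V? : {P : V → Set} → Decidable P → Dec (∀ x → P x)
∀V? = ∀-by-enumeration? allV ∈-allV

∃V? : {P : V → Set} → Decidable P → Dec (∃ P)
∃V? = ∃-by-enumeration? allV ∈-allV

decomposition : ∀ x → x ≡ ∑ (tabulate λ i → lookup x i ·V e i)
decomposition = toWitness {a? = ∀V? λ x → x ≟ⱽ ∑ (tabulate λ i → lookup x i ·V e i)} _

-- Monomial semilinear maps in coordinates

monomialMap : Galois → Vec (Fin 5) 5 → Vec F4 5 → V → V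
monomialMap s π c x = ∑ (tabulate λ i → ⟦ s ⟧ (lookup x i) ·V (lookup c i ·V e (lookup π i)))

Surjective : ∀ {n} → Vec (Fin n) n → Set
Surjective π = ∀ k → ∃ λ i → lookup π i ≡ k

surjective? : ∀ {n} (π : Vec (Fin n) n) → Dec (Surjective π)
surjective? π = ∀Fin? λ k → ∃Fin? λ i → lookup π i Finₚ.≟ k

lookup-monomialMap-missed : ∀ s π c x k → (∀ i → lookup π i ≢ k) → lookup (monomialMap s π c x) k ≡ 𝟎
lookup-monomialMap-missed s π c x k missed = lookup-∑-vanishing (tabulate term) k term-vanishes
  where
  term : Fin 5 → V
  term i = ⟦ s ⟧ (lookup x i) ·V (lookup c i ·V e (lookup π i))
  term-vanishes : ∀ i → lookup (lookup (tabulate term) i) k ≡ 𝟎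
  term-vanishes i = begin
    lookup (lookup (tabulate term) i) k  ≡⟨ cong (λ v → lookup v k) (Vecₚ.lookup∘tabulate term i) ⟩
    lookup (a ·V (b ·V e j)) k           ≡⟨ Vecₚ.lookup-map k (a ⊗_) (b ·V e j) ⟩
    a ⊗ lookup (b ·V e j) k              ≡⟨ cong (a ⊗_) (Vecₚ.lookup-map k (b ⊗_) (e j)) ⟩
    a ⊗ (b ⊗ lookup (e j) k)             ≡⟨ cong (λ z → a ⊗ (b ⊗ z)) (lookup-e-≢ (missed i)) ⟩
    a ⊗ (b ⊗ 𝟎)                          ≡⟨ cong (a ⊗_) (⊗-zeroʳ b) ⟩
    a ⊗ 𝟎                                ≡⟨ ⊗-zeroʳ a ⟩
    𝟎                                    ∎
    where
    a = ⟦ s ⟧ (lookup x i)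
    b = lookup c i
    j = lookup π i

-- An index k missed by π makes the k-th coordinate of every value vanish, so e k is not a value.
monomialMap-onto⇒Surjective : ∀ s π c → (∀ y → ∃ λ x → monomialMap s π c x ≡ y) → Surjective π
monomialMap-onto⇒Surjective s π c onto k with ∃Fin? (λ i → lookup π i Finₚ.≟ k)
... | yes hit  = hit
... | no  ¬hit = let x , fx≡ek = onto (e k) in ⊥-elim (𝟏≢𝟎 (begin
  𝟏                               ≡⟨ sym (lookup-e-≡ k) ⟩
  lookup (e k) k                  ≡⟨ cong (λ v → lookup v k) (sym fx≡ek) ⟩
  lookup (monomialMap s π c x) k  ≡⟨ lookup-monomialMap-missed s π c x k (λ i π[i]≡k → ¬hit (i , π[i]≡k)) ⟩
  𝟎                               ∎))
  where
  𝟏≢𝟎 : 𝟏 ≢ 𝟎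
  𝟏≢𝟎 ()

record MonomialForm (f : V → V) : Set where
  field
    twist                : Galois
    positions            : Vec (Fin 5) 5
    coefficients         : Vec F4 5
    positions-surjective : Surjective positions
    coefficients-nonzero : ∀ i → lookup coefficients i ≢ 𝟎
    form                 : f ≗ monomialMap twist positions coefficients

module _ (g : MonSemilinAut) where

  fun-0V : fun g 0V ≡ 0V
  fun-0V = begin
    fun g (𝟎 ·V 0V)       ≡⟨ semilin g 𝟎 0V ⟩
    σ g 𝟎 ·V fun g 0V     ≡⟨ cong (_·V fun g 0V) (aut-𝟎 (σ-aut g)) ⟩
    𝟎 ·V fun g 0V         ≡⟨ ·V-zeroˡ (fun g 0V) ⟩
    0V                    ∎

  fun-∑ : ∀ {n} (vs : Vec V n) → fun g (∑ vs) ≡ ∑ (map (fun g) vs)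
  fun-∑ []       = fun-0V
  fun-∑ (v ∷ vs) = trans (additive g v (∑ vs)) (cong (fun g v +V_) (fun-∑ vs))

  monomialForm : MonomialForm (fun g)
  monomialForm = record
    { twist                = s
    ; positions            = tabulate target
    ; coefficients         = tabulate coefficient
    ; positions-surjective = monomialMap-onto⇒Surjective s (tabulate target) (tabulate coefficient) λ y →
                               let x , gx≡y = onto y in x , trans (sym (form x)) gx≡y
    ; coefficients-nonzero = λ i → subst (_≢ 𝟎) (sym (Vecₚ.lookup∘tabulate coefficient i)) (proj₁ (proj₂ (proj₂ (monomial g i))))
    ; form                 = form
    }
    where
    s = proj₁ (aut-classification (σ-aut g))
    target : Fin 5 → Fin 5
    target i = proj₁ (monomial g i)
    coefficient : Fin 5 → F4
    coefficient i = proj₁ (proj₂ (monomial g i))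

    onto : ∀ y → ∃ λ x → fun g x ≡ y
    onto y = let x , gz≡y = proj₂ (bijective g) y in x , gz≡y refl

    basis-image : ∀ a i → fun g (a ·V e i) ≡ ⟦ s ⟧ a ·V (lookup (tabulate coefficient) i ·V e (lookup (tabulate target) i))
    basis-image a i = begin
      fun g (a ·V e i)                                ≡⟨ semilin g a (e i) ⟩
      σ g a ·V fun g (e i)                            ≡⟨ cong₂ _·V_ (proj₂ (aut-classification (σ-aut g)) a) (proj₂ (proj₂ (proj₂ (monomial g i)))) ⟩
      ⟦ s ⟧ a ·V (coefficient i ·V e (target i))      ≡⟨ sym (cong₂ (λ b j → ⟦ s ⟧ a ·V (b ·V e j))
                                                           (Vecₚ.lookup∘tabulate coefficient i) (Vecₚ.lookup∘tabulate target i)) ⟩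
      ⟦ s ⟧ a ·V (lookup (tabulate coefficient) i ·V e (lookup (tabulate target) i)) ∎

    form : fun g ≗ monomialMap s (tabulate target) (tabulate coefficient)
    form x = begin
      fun g x                                            ≡⟨ cong (fun g) (decomposition x) ⟩
      fun g (∑ (tabulate λ i → lookup x i ·V e i))       ≡⟨ fun-∑ (tabulate λ i → lookup x i ·V e i) ⟩
      ∑ (map (fun g) (tabulate λ i → lookup x i ·V e i)) ≡⟨ cong ∑ (sym (Vecₚ.tabulate-∘ (fun g) λ i → lookup x i ·V e i)) ⟩
      ∑ (tabulate λ i → fun g (lookup x i ·V e i))       ≡⟨ cong ∑ (Vecₚ.tabulate-cong λ i → basis-image (lookup x i) i) ⟩
      monomialMap s (tabulate target) (tabulate coefficient) x ∎

MapsInto : (V → V) → (V → Set) → Set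
MapsInto f M = ∀ x → M x → M (f x)

Preserves⇒MapsInto : ∀ {M} g → Preserves M g → MapsInto (fun g) M
Preserves⇒MapsInto g preserves x Mx = proj₁ (preserves (fun g x)) (x , Mx , refl)

MapsInto-resp-≗ : ∀ {f f′ M} → f ≗ f′ → MapsInto f M → MapsInto f′ M
MapsInto-resp-≗ {M = M} f≗f′ f[M]⊆M x Mx = subst M (f≗f′ x) (f[M]⊆M x Mx)

lookup-combination : ∀ a b u v k → lookup (a ·V u +V b ·V v) k ≡ a ⊗ lookup u k ⊕ b ⊗ lookup v k
lookup-combination a b u v k = begin
  lookup (a ·V u +V b ·V v) k                ≡⟨ Vecₚ.lookup-zipWith _⊕_ k (a ·V u) (b ·V v) ⟩
  lookup (a ·V u) k ⊕ lookup (b ·V v) k      ≡⟨ cong₂ _⊕_ (Vecₚ.lookup-map k (a ⊗_) u) (Vecₚ.lookup-map k (b ⊗_) v) ⟩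
  a ⊗ lookup u k ⊕ b ⊗ lookup v k            ∎

-- For a basis with these leading coordinates, the coefficients of w in span₂ u v are w₁ and w₀.
Normalised : V → V → Set
Normalised u v = lookup u 0F ≡ 𝟎 × lookup u 1F ≡ 𝟏 × lookup v 0F ≡ 𝟏 × lookup v 1F ≡ 𝟎

span₂? : ∀ {u v} → Normalised u v → Decidable (span₂ u v)
span₂? {u} {v} normalised w =
  map′ (λ w≡ → lookup w 1F , lookup w 0F , w≡) (coefficients normalised) (w ≟ⱽ lookup w 1F ·V u +V lookup w 0F ·V v)
  where
  coefficients : Normalised u v → span₂ u v w → w ≡ lookup w 1F ·V u +V lookup w 0F ·V v
  coefficients (u₀ , u₁ , v₀ , v₁) (a , b , w≡au+bv) =
    trans w≡au+bv (cong₂ (λ a b → a ·V u +V b ·V v) (sym w₁≡a) (sym w₀≡b))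
    where
    w₁≡a : lookup w 1F ≡ a
    w₁≡a = begin
      lookup w 1F                       ≡⟨ cong (λ z → lookup z 1F) w≡au+bv ⟩
      lookup (a ·V u +V b ·V v) 1F      ≡⟨ lookup-combination a b u v 1F ⟩
      a ⊗ lookup u 1F ⊕ b ⊗ lookup v 1F ≡⟨ cong₂ (λ x y → a ⊗ x ⊕ b ⊗ y) u₁ v₁ ⟩
      a ⊗ 𝟏 ⊕ b ⊗ 𝟎                     ≡⟨ cong₂ _⊕_ (⊗-identityʳ a) (⊗-zeroʳ b) ⟩
      a ⊕ 𝟎                             ≡⟨ ⊕-identityʳ a ⟩
      a                                 ∎
    w₀≡b : lookup w 0F ≡ b
    w₀≡b = begin
      lookup w 0F                       ≡⟨ cong (λ z → lookup z 0F) w≡au+bv ⟩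
      lookup (a ·V u +V b ·V v) 0F      ≡⟨ lookup-combination a b u v 0F ⟩
      a ⊗ lookup u 0F ⊕ b ⊗ lookup v 0F ≡⟨ cong₂ (λ x y → a ⊗ x ⊕ b ⊗ y) u₀ v₀ ⟩
      a ⊗ 𝟎 ⊕ b ⊗ 𝟏                     ≡⟨ cong₂ _⊕_ (⊗-zeroʳ a) (⊗-identityʳ b) ⟩
      b                                 ∎

mapsInto? : ∀ {u v} → Normalised u v → (f : V → V) → Dec (MapsInto f (span₂ u v))
mapsInto? {u} {v} normalised f =
  map′ (λ h x (a , b , x≡au+bv) → subst (λ x → span₂ u v (f x)) (sym x≡au+bv) (h a b))
       (λ f[M]⊆M a b → f[M]⊆M _ (a , b , refl))
       (∀F4? λ a → ∀F4? λ b → span₂? normalised (f (a ·V u +V b ·V v)))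

uL vL u136 v136 : V
uL   = 𝟎 ∷ 𝟏 ∷ 𝟏 ∷ 𝟏 ∷ 𝟏 ∷ []
vL   = 𝟏 ∷ 𝟎 ∷ 𝟏 ∷ α ∷ α² ∷ []
u136 = 𝟎 ∷ 𝟏 ∷ 𝟏 ∷ α ∷ α ∷ []
v136 = 𝟏 ∷ 𝟎 ∷ 𝟏 ∷ α² ∷ 𝟏 ∷ []

PreservesLines : (V → V) → Set
PreservesLines f = MapsInto f L × MapsInto f L136

L-normalised : Normalised uL vL
L-normalised = refl , refl , refl , refl

L136-normalised : Normalised u136 v136
L136-normalised = refl , refl , refl , refl

preservesLines? : (f : V → V) → Dec (PreservesLines f)
preservesLines? f = mapsInto? L-normalised f ×-dec mapsInto? L136-normalised f

-- Weaker than PreservesLines but much cheaper to decide, and all the classification needs.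
MapsBasesIntoLines : (V → V) → Set
MapsBasesIntoLines f = L (f uL) × L (f vL) × L136 (f u136) × L136 (f v136)

mapsBasesIntoLines? : (f : V → V) → Dec (MapsBasesIntoLines f)
mapsBasesIntoLines? f = span₂? L-normalised (f uL) ×-dec span₂? L-normalised (f vL) ×-dec
                        span₂? L136-normalised (f u136) ×-dec span₂? L136-normalised (f v136)

PreservesLines⇒MapsBasesIntoLines : ∀ {f} → PreservesLines f → MapsBasesIntoLines f
PreservesLines⇒MapsBasesIntoLines (f[L]⊆L , f[L136]⊆L136) =
  f[L]⊆L uL (𝟏 , 𝟎 , refl) , f[L]⊆L vL (𝟎 , 𝟏 , refl) ,
  f[L136]⊆L136 u136 (𝟏 , 𝟎 , refl) , f[L136]⊆L136 v136 (𝟎 , 𝟏 , refl)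

module _ (g h : MonSemilinAut) {μ : F4} (μ≢𝟎 : μ ≢ 𝟎) (g≗μh : ∀ x → fun g x ≡ μ ·V fun h x) where

  private
    σ-preimage : ∀ a → ∃ λ b → σ h b ≡ a
    σ-preimage a = let b , σ[z≡b]≡a = proj₂ (IsFieldAut.bij (σ-aut h)) a in b , σ[z≡b]≡a refl

  -- As σ h is onto, the factor μ is absorbed by rescaling the argument inside W.
  proportional⇒SameProj : SameProj g h
  proportional⇒SameProj W y = g[W]⊆h[W] , h[W]⊆g[W]
    where
    g[W]⊆h[W] : image (fun g) (mem W) y → image (fun h) (mem W) y
    g[W]⊆h[W] (x , Wx , gx≡y) = let ν , σν≡μ = σ-preimage μ in
      ν ·V x , scal W ν x Wx , (begin
        fun h (ν ·V x)      ≡⟨ semilin h ν x ⟩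
        σ h ν ·V fun h x    ≡⟨ cong (_·V fun h x) σν≡μ ⟩
        μ ·V fun h x        ≡⟨ sym (g≗μh x) ⟩
        fun g x             ≡⟨ gx≡y ⟩
        y                   ∎)
    h[W]⊆g[W] : image (fun h) (mem W) y → image (fun g) (mem W) y
    h[W]⊆g[W] (x , Wx , hx≡y) = let ν , σν≡μ⁻¹ = σ-preimage (μ ⁻¹) in
      ν ·V x , scal W ν x Wx , (begin
        fun g (ν ·V x)             ≡⟨ g≗μh (ν ·V x) ⟩
        μ ·V fun h (ν ·V x)        ≡⟨ cong (μ ·V_) (semilin h ν x) ⟩
        μ ·V (σ h ν ·V fun h x)    ≡⟨ cong (λ a → μ ·V (a ·V fun h x)) σν≡μ⁻¹ ⟩
        μ ·V (μ ⁻¹ ·V fun h x)     ≡⟨ ·V-assoc μ (μ ⁻¹) (fun h x) ⟩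
        (μ ⊗ μ ⁻¹) ·V fun h x      ≡⟨ cong (_·V fun h x) (⊗-inverseʳ μ≢𝟎) ⟩
        𝟏 ·V fun h x               ≡⟨ ·V-identityˡ (fun h x) ⟩
        fun h x                    ≡⟨ hx≡y ⟩
        y                          ∎)

line : V → Subspace
line w = record
  { mem  = λ x → ∃ λ a → x ≡ a ·V w
  ; has0 = 𝟎 , sym (·V-zeroˡ w)
  ; add  = λ { _ _ (a , refl) (b , refl) → a ⊕ b , ·V-distribʳ a b w }
  ; scal = λ { c _ (a , refl) → c ⊗ a , ·V-assoc c a w }
  }

SameProj⇒same-line : ∀ g h → SameProj g h → ∀ w → ∃ λ a → fun h (a ·V w) ≡ fun g w
SameProj⇒same-line g h same w =
  let x , (a , x≡aw) , hx≡gw = proj₁ (same (line w) (fun g w)) (w , (𝟏 , sym (·V-identityˡ w)) , refl)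
  in a , trans (cong (fun h) (sym x≡aw)) hx≡gw

iterate-suc : ∀ {A : Set} (f : A → A) x m → iterate f (f x) m ≡ f (iterate f x m)
iterate-suc f x ℕ.zero    = refl
iterate-suc f x (ℕ.suc m) = iterate-suc f (f x) m

module _ {A : Set} {f : A → A} {m : ℕ} (periodic : ∀ x → iterate f x (ℕ.suc m) ≡ x) where

  periodic⇒bijective : Bijective _≡_ _≡_ f
  periodic⇒bijective = injective , surjective
    where
    injective : ∀ {x y} → f x ≡ f y → x ≡ y
    injective {x} {y} fx≡fy = trans (sym (periodic x)) (trans (cong (λ z → iterate f z m) fx≡fy) (periodic y))
    surjective : ∀ y → ∃ λ x → ∀ {z} → z ≡ x → f z ≡ y
    surjective y = iterate f y m , λ z≡x → trans (cong f z≡x) (trans (sym (iterate-suc f y m)) (periodic y))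

module _ {f : V → V} {m : ℕ} (periodic : ∀ x → iterate f x (ℕ.suc m) ≡ x) {M : V → Set} (f[M]⊆M : MapsInto f M) where

  iterate-MapsInto : ∀ n → MapsInto (λ x → iterate f x n) M
  iterate-MapsInto ℕ.zero    x Mx = Mx
  iterate-MapsInto (ℕ.suc n) x Mx = iterate-MapsInto n (f x) (f[M]⊆M x Mx)

  periodic-MapsInto⇒image≡ : SameSet (image f M) M
  periodic-MapsInto⇒image≡ y = f[M]⊆M′ , M⊆f[M]
    where
    f[M]⊆M′ : image f M y → M y
    f[M]⊆M′ (x , Mx , fx≡y) = subst M fx≡y (f[M]⊆M x Mx)
    M⊆f[M] : M y → image f M y
    M⊆f[M] My = iterate f y m , iterate-MapsInto m y My , trans (sym (iterate-suc f y m)) (periodic y)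

-- The six symmetries

scaledPermutation : Vec (Fin 5) 5 → Vec F4 5 → V → V
scaledPermutation p d x = tabulate λ k → lookup x (lookup p k) ⊗ lookup d k

module _ (p : Vec (Fin 5) 5) (d : Vec F4 5) where

  private
    f = scaledPermutation p d

    lookup-f : ∀ x k → lookup (f x) k ≡ lookup x (lookup p k) ⊗ lookup d k
    lookup-f x = Vecₚ.lookup∘tabulate λ k → lookup x (lookup p k) ⊗ lookup d k

  scaledPermutation-additive : ∀ x y → f (x +V y) ≡ f x +V f y
  scaledPermutation-additive x y = ≡-by-lookup λ k → let j = lookup p k ; c = lookup d k in begin
    lookup (f (x +V y)) k              ≡⟨ lookup-f (x +V y) k ⟩
    lookup (x +V y) j ⊗ c              ≡⟨ cong (_⊗ c) (Vecₚ.lookup-zipWith _⊕_ j x y) ⟩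
    (lookup x j ⊕ lookup y j) ⊗ c      ≡⟨ ⊗-distribʳ-⊕ c (lookup x j) (lookup y j) ⟩
    lookup x j ⊗ c ⊕ lookup y j ⊗ c    ≡⟨ sym (cong₂ _⊕_ (lookup-f x k) (lookup-f y k)) ⟩
    lookup (f x) k ⊕ lookup (f y) k    ≡⟨ sym (Vecₚ.lookup-zipWith _⊕_ k (f x) (f y)) ⟩
    lookup (f x +V f y) k              ∎

  scaledPermutation-linear : ∀ a x → f (a ·V x) ≡ a ·V f x
  scaledPermutation-linear a x = ≡-by-lookup λ k → let j = lookup p k ; c = lookup d k in begin
    lookup (f (a ·V x)) k              ≡⟨ lookup-f (a ·V x) k ⟩
    lookup (a ·V x) j ⊗ c              ≡⟨ cong (_⊗ c) (Vecₚ.lookup-map j (a ⊗_) x) ⟩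
    (a ⊗ lookup x j) ⊗ c               ≡⟨ ⊗-assoc a (lookup x j) c ⟩
    a ⊗ (lookup x j ⊗ c)               ≡⟨ sym (cong (a ⊗_) (lookup-f x k)) ⟩
    a ⊗ lookup (f x) k                 ≡⟨ sym (Vecₚ.lookup-map k (a ⊗_) (f x)) ⟩
    lookup (a ·V f x) k                ∎

permutation : Fin 6 → Vec (Fin 5) 5
permutation 0F = 0F ∷ 1F ∷ 2F ∷ 3F ∷ 4F ∷ []
permutation 1F = 0F ∷ 2F ∷ 1F ∷ 4F ∷ 3F ∷ []
permutation 2F = 1F ∷ 0F ∷ 2F ∷ 4F ∷ 3F ∷ []
permutation 3F = 2F ∷ 0F ∷ 1F ∷ 3F ∷ 4F ∷ []
permutation 4F = 1F ∷ 2F ∷ 0F ∷ 3F ∷ 4F ∷ []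
permutation 5F = 2F ∷ 1F ∷ 0F ∷ 4F ∷ 3F ∷ []

scaling : Fin 6 → Vec F4 5
scaling 0F = 𝟏 ∷ 𝟏 ∷ 𝟏 ∷ 𝟏  ∷ 𝟏  ∷ []
scaling 1F = 𝟏 ∷ 𝟏 ∷ 𝟏 ∷ 𝟏  ∷ 𝟏  ∷ []
scaling 2F = 𝟏 ∷ 𝟏 ∷ 𝟏 ∷ α  ∷ α² ∷ []
scaling 3F = 𝟏 ∷ 𝟏 ∷ 𝟏 ∷ α  ∷ α² ∷ []
scaling 4F = 𝟏 ∷ 𝟏 ∷ 𝟏 ∷ α² ∷ α  ∷ []
scaling 5F = 𝟏 ∷ 𝟏 ∷ 𝟏 ∷ α² ∷ α  ∷ []

symmetry : Fin 6 → V → V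
symmetry k = scaledPermutation (permutation k) (scaling k)

symmetry-period : ∀ k x → iterate (symmetry k) x 6 ≡ x
symmetry-period = toWitness {a? = ∀Fin? λ k → ∀V? λ x → iterate (symmetry k) x 6 ≟ⱽ x} _

symmetry-monomial : ∀ k i → Σ (Fin 5) λ j → Σ F4 λ c → c ≢ 𝟎 × symmetry k (e i) ≡ c ·V e j
symmetry-monomial k i = let j , c , c∈units , image≡ = search k i in j , c , ∈-units⇒≢𝟎 c∈units , image≡
  where
  search : ∀ k i → ∃ λ j → ∃ λ c → c ∈ units × symmetry k (e i) ≡ c ·V e j
  search = toWitness {a? = ∀Fin? λ k → ∀Fin? λ i → ∃Fin? λ j → ∃∈? (λ c → symmetry k (e i) ≟ⱽ c ·V e j) units} _

symmetries : Fin 6 → MonSemilinAut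
symmetries k = record
  { fun       = symmetry k
  ; σ         = λ a → a
  ; σ-aut     = identity-aut
  ; additive  = scaledPermutation-additive (permutation k) (scaling k)
  ; semilin   = scaledPermutation-linear (permutation k) (scaling k)
  ; bijective = periodic⇒bijective {m = 5} (symmetry-period k)
  ; monomial  = symmetry-monomial k
  }

symmetry-preservesLines : ∀ k → PreservesLines (symmetry k)
symmetry-preservesLines = toWitness {a? = ∀Fin? λ k → preservesLines? (symmetry k)} _

symmetries-preserve : ∀ k → Preserves L (symmetries k) × Preserves L136 (symmetries k)
symmetries-preserve k =
  periodic-MapsInto⇒image≡ {m = 5} (symmetry-period k) (proj₁ (symmetry-preservesLines k)) ,
  periodic-MapsInto⇒image≡ {m = 5} (symmetry-period k) (proj₂ (symmetry-preservesLines k))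

symmetries-separated : ∀ i j → i ≡ j ⊎ ∃ λ w → ∀ a → symmetry j (a ·V w) ≢ symmetry i w
symmetries-separated = toWitness {a? = ∀Fin? λ i → ∀Fin? λ j → i Finₚ.≟ j ⊎-dec
                                   ∃V? λ w → ∀F4? λ a → ¬? (symmetry j (a ·V w) ≟ⱽ symmetry i w)} _

symmetries-distinct : ∀ i j → SameProj (symmetries i) (symmetries j) → i ≡ j
-- Eliminating by [_,_]′ rather than `with` keeps Agda from normalising the computed proof.
symmetries-distinct i j same = [ (λ i≡j → i≡j) , absurd ]′ (symmetries-separated i j)
  where
  absurd : (∃ λ w → ∀ a → symmetry j (a ·V w) ≢ symmetry i w) → i ≡ j
  absurd (w , off-line) = let a , on-line = SameProj⇒same-line (symmetries i) (symmetries j) same w in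
                          ⊥-elim (off-line a on-line)

-- Classification by exhaustion

surjections : List (Vec (Fin 5) 5)
surjections = filter surjective? (vectors (allFin 5) 5)

ProportionalToSymmetry : (V → V) → Set
ProportionalToSymmetry f = ∃ λ k → ∃ λ μ → μ ∈ units × ∀ x → f x ≡ μ ·V symmetry k x

proportionalToSymmetry? : (f : V → V) → Dec (ProportionalToSymmetry f)
proportionalToSymmetry? f = ∃Fin? λ k → ∃∈? (λ μ → ∀V? λ x → f x ≟ⱽ μ ·V symmetry k x) units

classification : ∀ s π c → Surjective π → (∀ i → lookup c i ≢ 𝟎) → MapsBasesIntoLines (monomialMap s π c) →
                 ∃₂ λ k μ → μ ≢ 𝟎 × ∀ x → monomialMap s π c x ≡ μ ·V symmetry k x
classification s π c π-surjective c≢𝟎 maps-bases =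
  let k , μ , μ∈units , f≗μg = exhaustion (∈-galois s) π∈surjections c∈units⁵ maps-bases
  in k , μ , ∈-units⇒≢𝟎 μ∈units , f≗μg
  where
  exhaustion : ∀ {s} → s ∈ galois → ∀ {π} → π ∈ surjections → ∀ {c} → c ∈ vectors units 5 →
               MapsBasesIntoLines (monomialMap s π c) → ProportionalToSymmetry (monomialMap s π c)
  exhaustion = toWitness {a? = ∀∈? (λ s → ∀∈? (λ π → ∀∈? (λ c →
                 mapsBasesIntoLines? (monomialMap s π c) →-dec proportionalToSymmetry? (monomialMap s π c))
                 (vectors units 5)) surjections) galois} _
  π∈surjections : π ∈ surjections
  π∈surjections = ∈-filter⁺ surjective? (∈-vectors π λ i → ∈-allFin (lookup π i)) π-surjective
  c∈units⁵ : c ∈ vectors units 5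
  c∈units⁵ = ∈-vectors c λ i → ∈-units (c≢𝟎 i)

lemma8 : Σ (Fin 6 → MonSemilinAut) λ gs →
           (∀ i → Preserves L (gs i) × Preserves L136 (gs i))
           × (∀ i j → SameProj (gs i) (gs j) → i ≡ j)
           × (∀ (g : MonSemilinAut) → Preserves L g → Preserves L136 g →
                Σ (Fin 6) λ i → SameProj g (gs i))
lemma8 = symmetries , symmetries-preserve , symmetries-distinct , completeness
  where
  completeness : ∀ g → Preserves L g → Preserves L136 g → Σ (Fin 6) λ i → SameProj g (symmetries i)
  completeness g preservesL preservesL136 =
    let open MonomialForm (monomialForm g)
        preserves = MapsInto-resp-≗ form (Preserves⇒MapsInto g preservesL) ,
                    MapsInto-resp-≗ form (Preserves⇒MapsInto g preservesL136)
        k , μ , μ≢𝟎 , f≗μg = classification twist positions coefficients positions-surjective coefficients-nonzero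
                                (PreservesLines⇒MapsBasesIntoLines preserves)
    in k , proportional⇒SameProj g (symmetries k) μ≢𝟎 (λ x → trans (form x) (f≗μg x))
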